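{- There is no symmetric association scheme $\mathcal{A} = (X, \{R_0, \dots, R_5\})$ with $R_0 = \mathrm{Id}_X$ whose intersection numbers, written as matrices $(p^h_{ij})_{i,j=0}^5$ for $h = 0,\dots,5$ (rows indexed by $i$, columns by $j$), are: $(p^0_{ij}) = \mathrm{diag}(1, 6, 18, 2, 6, 12)$; $(p^1_{ij})$ has rows $(0,1,0,0,0,0)$, $(1,0,3,0,2,0)$, $(0,3,9,0,0,6)$, $(0,0,0,0,0,2)$, $(0,2,0,0,0,4)$, $(0,0,6,2,4,0)$; $(p^2_{ij})$ has rows $(0,0,1,0,0,0)$, $(0,1,3,0,0,2)$, $(1,3,0,2,6,6)$, $(0,0,2,0,0,0)$, $(0,0,6,0,0,0)$, $(0,2,6,0,0,4)$; $(p^3_{ij})$ has rows $(0,0,0,1,0,0)$, $(0,0,0,0,0,6)$, $(0,0,18,0,0,0)$, $(1,0,0,1,0,0)$, $(0,0,0,0,6,0)$, $(0,6,0,0,0,6)$; $(p^4_{ij})$ has rows $(0,0,0,0,1,0)$, $(0,2,0,0,0,4)$, $(0,0,18,0,0,0)$, $(0,0,0,0,2,0)$, $(1,0,0,2,3,0)$, $(0,4,0,0,0,8)$; $(p^5_{ij})$ has rows $(0,0,0,0,0,1)$, $(0,0,3,1,2,0)$, $(0,3,9,0,0,6)$, $(0,1,0,0,0,1)$, $(0,2,0,0,0,4)$, $(1,0,6,1,4,0)$.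
   Context: A symmetric association scheme is a pair $(X, \{R_i \mid i \in \mathcal{I}\})$ where $X$ is a finite set and the $R_i$ are nonempty symmetric binary relations on $X$ partitioning $X^2$, with $R_0$ the identity relation, such that for all $h,i,j$ there is a number $p^h_{ij}$ (intersection number) with the property that for every $(x,y) \in R_h$ there are exactly $p^h_{ij}$ vertices $z$ with $(x,z) \in R_i$ and $(z,y) \in R_j$. (Such a scheme would have $45$ vertices.) -}

module Defs where

open import Data.Nat using (ℕ)
open import Data.Fin using (Fin)
open import Data.Fin.Properties using (_≟_)
open import Data.List using (List; []; _∷_; length; filter; allFin)
open import Data.Vec using (Vec; []; _∷_; lookup)
open import Data.Product using (_×_; Σ; ∃; ∃-syntax; _,_)
open import Relation.Nullary.Decidable using (_×-dec_)
open import Relation.Binary.PropositionalEquality using (_≡_)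

-- A finite set X is modelled as Fin n.  A partition of X² into relations
-- R₀,…,R_d is given by the function  rel : X → X → Fin (suc d)  sending
-- (x,y) to the index i with (x,y) ∈ R_i.

count : ∀ {n m} → (Fin n → Fin n → Fin m) → Fin m → Fin m → Fin n → Fin n → ℕ
count {n} rel i j x y =
  length (filter (λ z → (rel x z ≟ i) ×-dec (rel z y ≟ j)) (allFin n))

record IsSymmetricAssocScheme {n m : ℕ} (zero₀ : Fin m)
    (rel : Fin n → Fin n → Fin m) (p : Fin m → Fin m → Fin m → ℕ) : Set where
  field
    identity   : ∀ x y → (rel x y ≡ zero₀ → x ≡ y) × (x ≡ y → rel x y ≡ zero₀)
    symmetric  : ∀ x y → rel x y ≡ rel y x
    nonempty   : ∀ i → ∃[ x ] ∃[ y ] rel x y ≡ i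
    intersection : ∀ h i j x y → rel x y ≡ h → count rel i j x y ≡ p h i j

-- The given intersection numbers, p h i j = (p^h)_{ij}.
Mat : Set
Mat = Vec (Vec ℕ 6) 6

pTable : Vec Mat 6
pTable =
  ( (1 ∷ 0 ∷ 0 ∷ 0 ∷ 0 ∷ 0 ∷ []) ∷
    (0 ∷ 6 ∷ 0 ∷ 0 ∷ 0 ∷ 0 ∷ []) ∷
    (0 ∷ 0 ∷ 18 ∷ 0 ∷ 0 ∷ 0 ∷ []) ∷
    (0 ∷ 0 ∷ 0 ∷ 2 ∷ 0 ∷ 0 ∷ []) ∷
    (0 ∷ 0 ∷ 0 ∷ 0 ∷ 6 ∷ 0 ∷ []) ∷
    (0 ∷ 0 ∷ 0 ∷ 0 ∷ 0 ∷ 12 ∷ []) ∷ [] ) ∷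
  ( (0 ∷ 1 ∷ 0 ∷ 0 ∷ 0 ∷ 0 ∷ []) ∷
    (1 ∷ 0 ∷ 3 ∷ 0 ∷ 2 ∷ 0 ∷ []) ∷
    (0 ∷ 3 ∷ 9 ∷ 0 ∷ 0 ∷ 6 ∷ []) ∷
    (0 ∷ 0 ∷ 0 ∷ 0 ∷ 0 ∷ 2 ∷ []) ∷
    (0 ∷ 2 ∷ 0 ∷ 0 ∷ 0 ∷ 4 ∷ []) ∷
    (0 ∷ 0 ∷ 6 ∷ 2 ∷ 4 ∷ 0 ∷ []) ∷ [] ) ∷
  ( (0 ∷ 0 ∷ 1 ∷ 0 ∷ 0 ∷ 0 ∷ []) ∷
    (0 ∷ 1 ∷ 3 ∷ 0 ∷ 0 ∷ 2 ∷ []) ∷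
    (1 ∷ 3 ∷ 0 ∷ 2 ∷ 6 ∷ 6 ∷ []) ∷
    (0 ∷ 0 ∷ 2 ∷ 0 ∷ 0 ∷ 0 ∷ []) ∷
    (0 ∷ 0 ∷ 6 ∷ 0 ∷ 0 ∷ 0 ∷ []) ∷
    (0 ∷ 2 ∷ 6 ∷ 0 ∷ 0 ∷ 4 ∷ []) ∷ [] ) ∷
  ( (0 ∷ 0 ∷ 0 ∷ 1 ∷ 0 ∷ 0 ∷ []) ∷
    (0 ∷ 0 ∷ 0 ∷ 0 ∷ 0 ∷ 6 ∷ []) ∷
    (0 ∷ 0 ∷ 18 ∷ 0 ∷ 0 ∷ 0 ∷ []) ∷
    (1 ∷ 0 ∷ 0 ∷ 1 ∷ 0 ∷ 0 ∷ []) ∷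
    (0 ∷ 0 ∷ 0 ∷ 0 ∷ 6 ∷ 0 ∷ []) ∷
    (0 ∷ 6 ∷ 0 ∷ 0 ∷ 0 ∷ 6 ∷ []) ∷ [] ) ∷
  ( (0 ∷ 0 ∷ 0 ∷ 0 ∷ 1 ∷ 0 ∷ []) ∷
    (0 ∷ 2 ∷ 0 ∷ 0 ∷ 0 ∷ 4 ∷ []) ∷
    (0 ∷ 0 ∷ 18 ∷ 0 ∷ 0 ∷ 0 ∷ []) ∷
    (0 ∷ 0 ∷ 0 ∷ 0 ∷ 2 ∷ 0 ∷ []) ∷
    (1 ∷ 0 ∷ 0 ∷ 2 ∷ 3 ∷ 0 ∷ []) ∷
    (0 ∷ 4 ∷ 0 ∷ 0 ∷ 0 ∷ 8 ∷ []) ∷ [] ) ∷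
  ( (0 ∷ 0 ∷ 0 ∷ 0 ∷ 0 ∷ 1 ∷ []) ∷
    (0 ∷ 0 ∷ 3 ∷ 1 ∷ 2 ∷ 0 ∷ []) ∷
    (0 ∷ 3 ∷ 9 ∷ 0 ∷ 0 ∷ 6 ∷ []) ∷
    (0 ∷ 1 ∷ 0 ∷ 0 ∷ 0 ∷ 1 ∷ []) ∷
    (0 ∷ 2 ∷ 0 ∷ 0 ∷ 0 ∷ 4 ∷ []) ∷
    (1 ∷ 0 ∷ 6 ∷ 1 ∷ 4 ∷ 0 ∷ []) ∷ [] ) ∷ []

p : Fin 6 → Fin 6 → Fin 6 → ℕ
p h i j = lookup (lookup (lookup pTable h) i) j

{-# OPTIONS --safe #-}
module Submission where

-- Fix (w, y₀) ∈ R₁ and an R₃-triangle y₀, y₁, y₂ (p⁰₃₃ = 2, p³₃₃ = 1), and let Γ be the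
-- p¹₁₂ = 3 vertices x with (w, x) ∈ R₁ and (x, y₀) ∈ R₂; they are pairwise in R₄.  Every x ∈ Γ
-- is in R₂ with y₀, y₁ and y₂, so it has a common R₁-neighbour, a midpoint, with each of them,
-- w being one with y₀.  The key lemma midpoints-R₄, which rests on the counting argument
-- R₁R₂-transfer, says that midpoints of x with R₃-related vertices are in R₄.  Hence the
-- y₁-midpoints of Γ lie in {a | (y₁, a) ∈ R₁, (a, w) ∈ R₄}, of size p⁵₁₄ = 2, so those of some
-- x ≠ x′ coincide in a.  Then the y₂-midpoints b, b′ of x, x′ coincide as well, for otherwise b, b′
-- and the c with (y₂, c) ∈ R₁, (c, a) ∈ R₃ are three elements of the corresponding set for y₂.
-- But then w, a and b are three common R₁-neighbours of x and x′, whereas p⁴₁₁ = 2.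

open import Defs
open import Agda.Builtin.FromNat using (Number; fromNat)
open import Data.Empty using (⊥)
open import Data.Fin using (Fin; zero)
import Data.Fin.Literals as FinLiterals
open import Data.Fin.Properties using (_≟_; all?)
open import Data.List using (List; []; _∷_; _++_; length; filter; allFin)
open import Data.List.Properties using (length-++-sucʳ)
open import Data.List.Membership.Propositional.Properties
  using (∈-∃++; ∈-++⁻; ∈-++⁺ˡ; ∈-++⁺ʳ; ∈-filter⁺; ∈-allFin)
open import Data.List.Relation.Binary.Subset.Propositional using (_⊆_)
open import Data.List.Relation.Unary.All as All using (All; []; _∷_)
open import Data.List.Relation.Unary.All.Properties using (all-filter)
open import Data.List.Relation.Unary.Any using (here; there)
open import Data.List.Relation.Unary.Unique.Propositional using (Unique; []; _∷_)
open import Data.List.Relation.Unary.Unique.Propositional.Properties using (filter⁺; allFin⁺)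
import Data.Nat.Literals as ℕLiterals
open import Data.Nat using (ℕ; suc; _≤_; _<_; z≤n; s≤s; _<?_)
open import Data.Nat.Properties using (≤-refl; ≤-trans; ≤-reflexive; 1+n≰n; <⇒≢; module ≤-Reasoning)
open import Data.Product using (_×_; _,_; proj₁; proj₂; ∃; ∃-syntax)
open import Data.Sum using (_⊎_; inj₁; inj₂)
open import Data.Unit using (tt)
open import Function using (case_of_)
open import Relation.Binary.PropositionalEquality using (_≡_; _≢_; refl; sym; trans; subst; subst₂)
open import Relation.Nullary using (¬_; yes; no; contradiction)
open import Relation.Nullary.Decidable using (True; toWitness; _×-dec_; _→-dec_; _⊎-dec_)
open import Relation.Unary as U using (Pred; Decidable)

instance
  ℕ-literals : Number ℕ
  ℕ-literals = ℕLiterals.number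

  fin-literals : ∀ {n} → Number (Fin n)
  fin-literals = FinLiterals.number _

Unique-⊆⇒length≤ : ∀ {a} {A : Set a} {xs ys : List A} → Unique xs → xs ⊆ ys → length xs ≤ length ys
Unique-⊆⇒length≤ [] _ = z≤n
Unique-⊆⇒length≤ {xs = x ∷ xs} (x≢xs ∷ unique) xs⊆ys
  with us , vs , refl ← ∈-∃++ (xs⊆ys (here refl)) = begin
    suc (length xs)         ≤⟨ s≤s (Unique-⊆⇒length≤ unique xs⊆us++vs) ⟩
    suc (length (us ++ vs)) ≡⟨ length-++-sucʳ us x vs ⟨
    length (us ++ x ∷ vs)   ∎
  where
  open ≤-Reasoning
  xs⊆us++vs : xs ⊆ us ++ vs
  xs⊆us++vs y∈xs with ∈-++⁻ us (xs⊆ys (there y∈xs))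
  ... | inj₁ y∈us         = ∈-++⁺ˡ y∈us
  ... | inj₂ (here refl)  = contradiction refl (All.lookup x≢xs y∈xs)
  ... | inj₂ (there y∈vs) = ∈-++⁺ʳ us y∈vs

Unique-All⇒length≤count : ∀ {n ℓ} {P : Pred (Fin n) ℓ} (P? : Decidable P) {zs : List (Fin n)} →
                          Unique zs → All P zs → length zs ≤ length (filter P? (allFin n))
Unique-All⇒length≤count P? unique Pzs =
  Unique-⊆⇒length≤ unique λ z∈zs → ∈-filter⁺ P? (∈-allFin _) (All.lookup Pzs z∈zs)

⊆-count≥⇒⊇ : ∀ {n ℓ} {P Q : Pred (Fin n) ℓ} (P? : Decidable P) (Q? : Decidable Q) → P U.⊆ Q →
             length (filter Q? (allFin n)) ≤ length (filter P? (allFin n)) → Q U.⊆ P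
⊆-count≥⇒⊇ {n} {P = P} P? Q? P⊆Q #Q≤#P {z} Qz with P? z
... | yes Pz = Pz
... | no ¬Pz = contradiction (≤-trans #z∷P≤#Q #Q≤#P) 1+n≰n
  where
  z∉P : All (z ≢_) (filter P? (allFin n))
  z∉P = All.map (λ Pu z≡u → ¬Pz (subst P (sym z≡u) Pu)) (all-filter P? (allFin n))
  #z∷P≤#Q : suc (length (filter P? (allFin n))) ≤ length (filter Q? (allFin n))
  #z∷P≤#Q = Unique-All⇒length≤count Q? (z∉P ∷ filter⁺ P? (allFin⁺ n))
                                       (Qz ∷ All.map P⊆Q (all-filter P? (allFin n)))

module SymmetricAssocScheme {n m} {0# : Fin m} {rel : Fin n → Fin n → Fin m}
                            {p : Fin m → Fin m → Fin m → ℕ}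
                            (S : IsSymmetricAssocScheme 0# rel p) where

  open IsSymmetricAssocScheme S public

  private variable
    x y z x′ y′ : Fin n
    h i j h′ i′ j′ : Fin m

  Between : Fin m → Fin m → Fin n → Fin n → Pred (Fin n) _
  Between i j x y z = rel x z ≡ i × rel z y ≡ j

  between? : ∀ i j x y → Decidable (Between i j x y)
  between? i j x y z = (rel x z ≟ i) ×-dec (rel z y ≟ j)

  rel-sym : rel x y ≡ i → rel y x ≡ i
  rel-sym {x} {y} xy = trans (symmetric y x) xy

  rel-refl : rel x x ≡ 0#
  rel-refl {x} = proj₂ (identity x x) refl

  rel≡0#⇒≡ : rel x y ≡ 0# → x ≡ y
  rel≡0#⇒≡ {x} {y} = proj₁ (identity x y)

  different-classes⇒≢ : rel x z ≡ i → rel y z ≡ j → i ≢ j → x ≢ y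
  different-classes⇒≢ xz yz i≢j refl = i≢j (trans (sym xz) yz)

  enumerate-Between : rel x y ≡ h →
                      ∃[ zs ] length zs ≡ p h i j × Unique zs × All (Between i j x y) zs
  enumerate-Between {x} {y} {h} {i} {j} xy =
    filter (between? i j x y) (allFin n) ,
    intersection h i j x y xy ,
    filter⁺ (between? i j x y) (allFin⁺ n) ,
    all-filter (between? i j x y) (allFin n)

  Unique-Between⇒length≤p : rel x y ≡ h → {zs : List (Fin n)} → Unique zs →
                            All (Between i j x y) zs → length zs ≤ p h i j
  Unique-Between⇒length≤p {x} {y} {h} {i} {j} xy unique between =
    ≤-trans (Unique-All⇒length≤count (between? i j x y) unique between)
            (≤-reflexive (intersection h i j x y xy))

  Between⇒0<p : Between i j x y z → 0 < p (rel x y) i j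
  Between⇒0<p z∈ = Unique-Between⇒length≤p refl ([] ∷ []) (z∈ ∷ [])

  0<p⇒∃Between : rel x y ≡ h → 0 < p h i j → ∃ (Between i j x y)
  0<p⇒∃Between {i = i} {j = j} xy 0<p with enumerate-Between {i = i} {j = j} xy
  ... | z ∷ _ , _ , _ , between ∷ _ = z , between
  ... | [] , 0≡p , _ = contradiction 0≡p (<⇒≢ 0<p)

  Between-⊇ : rel x y ≡ h → rel x′ y′ ≡ h′ → p h′ i′ j′ ≤ p h i j →
              Between i j x y U.⊆ Between i′ j′ x′ y′ → Between i′ j′ x′ y′ U.⊆ Between i j x y
  Between-⊇ {x} {y} {h} {x′} {y′} {h′} {i′} {j′} {i} {j} xy x′y′ p′≤p P⊆Q =
    ⊆-count≥⇒⊇ (between? i j x y) (between? i′ j′ x′ y′) P⊆Q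
      (subst₂ _≤_ (sym (intersection h′ i′ j′ x′ y′ x′y′)) (sym (intersection h i j x y xy)) p′≤p)

decide-∀ : ∀ {m ℓ} {P : Pred (Fin m) ℓ} (P? : Decidable P) → {True (all? P?)} → ∀ h → P h
decide-∀ P? {all-P} = toWitness all-P

module _ {n} {rel : Fin n → Fin n → Fin 6} (S : IsSymmetricAssocScheme zero rel p) where

  open SymmetricAssocScheme S

  private variable
    a a′ b b′ w x x′ y y′ z z′ : Fin n

  R₁R₃⊆R₅ : rel x z ≡ 1 → rel z y ≡ 3 → rel x y ≡ 5
  R₁R₃⊆R₅ xz zy = decide-∀ (λ h → 0 <? p h 1 3 →-dec h ≟ 5) _ (Between⇒0<p (xz , zy))

  R₂R₃⊆R₂ : rel x z ≡ 2 → rel z y ≡ 3 → rel x y ≡ 2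
  R₂R₃⊆R₂ xz zy = decide-∀ (λ h → 0 <? p h 2 3 →-dec h ≟ 2) _ (Between⇒0<p (xz , zy))

  R₃R₄⊆R₄ : rel x z ≡ 3 → rel z y ≡ 4 → rel x y ≡ 4
  R₃R₄⊆R₄ xz zy = decide-∀ (λ h → 0 <? p h 3 4 →-dec h ≟ 4) _ (Between⇒0<p (xz , zy))

  R₁R₁⊆R₀∪R₂∪R₄ : rel x z ≡ 1 → rel z y ≡ 1 → rel x y ≡ 0 ⊎ rel x y ≡ 2 ⊎ rel x y ≡ 4
  R₁R₁⊆R₀∪R₂∪R₄ xz zy =
    decide-∀ (λ h → 0 <? p h 1 1 →-dec (h ≟ 0 ⊎-dec h ≟ 2 ⊎-dec h ≟ 4)) _ (Between⇒0<p (xz , zy))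

  R₂R₁∩R₁R₁⊆R₂ : rel x z ≡ 2 → rel z y ≡ 1 → rel x z′ ≡ 1 → rel z′ y ≡ 1 → rel x y ≡ 2
  R₂R₁∩R₁R₁⊆R₂ xz zy xz′ z′y =
    decide-∀ (λ h → 0 <? p h 2 1 →-dec 0 <? p h 1 1 →-dec h ≟ 2) _
             (Between⇒0<p (xz , zy)) (Between⇒0<p (xz′ , z′y))

  R₁R₁∩R₂R₂⊆R₀∪R₄ : rel x z ≡ 1 → rel z y ≡ 1 → rel x z′ ≡ 2 → rel z′ y ≡ 2 →
                    rel x y ≡ 0 ⊎ rel x y ≡ 4
  R₁R₁∩R₂R₂⊆R₀∪R₄ xz zy xz′ z′y =
    decide-∀ (λ h → 0 <? p h 1 1 →-dec 0 <? p h 2 2 →-dec (h ≟ 0 ⊎-dec h ≟ 4)) _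
             (Between⇒0<p (xz , zy)) (Between⇒0<p (xz′ , z′y))

  -- Between 1 2 x y ⊆ Between 1 2 x w, and both have p²₁₂ = p¹₁₂ = 3 elements.
  R₁R₂-transfer : rel x w ≡ 1 → rel w y ≡ 1 → rel x y ≡ 2 → Between 1 2 x w U.⊆ Between 1 2 x y
  R₁R₂-transfer xw wy xy =
    Between-⊇ xy xw ≤-refl λ (xz , zy) → xz , R₂R₁∩R₁R₁⊆R₂ zy (rel-sym wy) (rel-sym xz) xw

  midpoints-R₄ : rel x y ≡ 2 → rel y y′ ≡ 3 → Between 1 1 x y a → Between 1 1 x y′ b → rel b a ≡ 4
  midpoints-R₄ {y = y} {b = b} xy yy′ (xa , ay) (xb , by′) =
    case R₁R₁⊆R₀∪R₂∪R₄ (rel-sym xb) xa of λ where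
      (inj₁ ba)        → contradiction (rel≡0#⇒≡ ba) (different-classes⇒≢ by ay λ ())
      (inj₂ (inj₁ ba)) → contradiction (trans (sym (proj₂ (R₁R₂-transfer xa ay xy (xb , ba)))) by)
                                       λ ()
      (inj₂ (inj₂ ba)) → ba
    where
    by : rel b y ≡ 5
    by = R₁R₃⊆R₅ by′ (rel-sym yy′)

  distinct₃ : x ≢ y → x ≢ z → y ≢ z → Unique (x ∷ y ∷ z ∷ [])
  distinct₃ x≢y x≢z y≢z = (x≢y ∷ x≢z ∷ []) ∷ (y≢z ∷ []) ∷ [] ∷ []

  module Triangle {w y₀ y₁ y₂ : Fin n} (wy₀ : rel w y₀ ≡ 1)
                  (y₀y₁ : rel y₀ y₁ ≡ 3) (y₀y₂ : rel y₀ y₂ ≡ 3) (y₁y₂ : rel y₁ y₂ ≡ 3) where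

    Γ : Pred (Fin n) _
    Γ = Between 1 2 w y₀

    Γ-R₄ : Γ x → Γ x′ → x ≢ x′ → rel x x′ ≡ 4
    Γ-R₄ (wx , xy₀) (wx′ , x′y₀) x≢x′ =
      case R₁R₁∩R₂R₂⊆R₀∪R₄ (rel-sym wx) wx′ xy₀ (rel-sym x′y₀) of λ where
        (inj₁ xx′) → contradiction (rel≡0#⇒≡ xx′) x≢x′
        (inj₂ xx′) → xx′

    midpoint : Γ x → rel y₀ y ≡ 3 → ∃ (Between 1 1 x y)
    midpoint (_ , xy₀) y₀y = 0<p⇒∃Between (R₂R₃⊆R₂ xy₀ y₀y) (s≤s z≤n)

    midpoint-w-R₄ : Γ x → rel y₀ y ≡ 3 → Between 1 1 x y a → rel a w ≡ 4
    midpoint-w-R₄ (wx , xy₀) y₀y = midpoints-R₄ xy₀ y₀y (rel-sym wx , wy₀)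

    midpoint-∈-Γ₁₄ : Γ x → rel y₀ y ≡ 3 → Between 1 1 x y a → Between 1 4 y w a
    midpoint-∈-Γ₁₄ x∈Γ y₀y a∈x@(_ , ay) = rel-sym ay , midpoint-w-R₄ x∈Γ y₀y a∈x

    midpoints-y₁y₂-R₄ : Γ x → Between 1 1 x y₁ a → Between 1 1 x y₂ b → rel b a ≡ 4
    midpoints-y₁y₂-R₄ (_ , xy₀) = midpoints-R₄ (R₂R₃⊆R₂ xy₀ y₀y₁) y₁y₂

    y₁w : rel y₁ w ≡ 5
    y₁w = rel-sym (R₁R₃⊆R₅ wy₀ y₀y₁)

    y₂w : rel y₂ w ≡ 5
    y₂w = rel-sym (R₁R₃⊆R₅ wy₀ y₀y₂)

    y₂-midpoints-coincide : Γ x → Γ x′ → Between 1 1 x y₁ a → Between 1 1 x′ y₁ a →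
                            Between 1 1 x y₂ b → Between 1 1 x′ y₂ b′ → b ≡ b′
    y₂-midpoints-coincide {b = b} {b′ = b′} x∈Γ x′∈Γ a∈x a∈x′ b∈x b′∈x′
      with c , y₂c , ca ← 0<p⇒∃Between (rel-sym (R₁R₃⊆R₅ (proj₂ a∈x) y₁y₂)) (s≤s z≤n) | b ≟ b′
    ... | yes b≡b′ = b≡b′
    ... | no b≢b′ = contradiction (Unique-Between⇒length≤p y₂w (distinct₃ b≢b′ b≢c b′≢c)
                                     (midpoint-∈-Γ₁₄ x∈Γ y₀y₂ b∈x ∷ midpoint-∈-Γ₁₄ x′∈Γ y₀y₂ b′∈x′ ∷
                                      (y₂c , R₃R₄⊆R₄ ca (midpoint-w-R₄ x∈Γ y₀y₁ a∈x)) ∷ []))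
                                  1+n≰n
      where
      b≢c : b ≢ c
      b≢c = different-classes⇒≢ (midpoints-y₁y₂-R₄ x∈Γ a∈x b∈x) ca λ ()
      b′≢c : b′ ≢ c
      b′≢c = different-classes⇒≢ (midpoints-y₁y₂-R₄ x′∈Γ a∈x′ b′∈x′) ca λ ()

    y₁-midpoints-differ : Γ x → Γ x′ → x ≢ x′ → Between 1 1 x y₁ a → Between 1 1 x′ y₁ a′ → a ≢ a′
    y₁-midpoints-differ {a = a} x∈Γ@(wx , _) x′∈Γ@(wx′ , _) x≢x′ a∈x@(xa , _) a∈x′@(x′a , _) refl
      with b , b∈x@(xb , _) ← midpoint x∈Γ y₀y₂ | b′ , b′∈x′ ← midpoint x′∈Γ y₀y₂
      with refl ← y₂-midpoints-coincide x∈Γ x′∈Γ a∈x a∈x′ b∈x b′∈x′ =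
      1+n≰n (Unique-Between⇒length≤p (Γ-R₄ x∈Γ x′∈Γ x≢x′) (distinct₃ w≢a w≢b a≢b)
               ((rel-sym wx , wx′) ∷ (xa , rel-sym x′a) ∷ (xb , rel-sym (proj₁ b′∈x′)) ∷ []))
      where
      w≢a : w ≢ a
      w≢a = different-classes⇒≢ rel-refl (midpoint-w-R₄ x∈Γ y₀y₁ a∈x) λ ()
      w≢b : w ≢ b
      w≢b = different-classes⇒≢ rel-refl (midpoint-w-R₄ x∈Γ y₀y₂ b∈x) λ ()
      a≢b : a ≢ b
      a≢b = different-classes⇒≢ rel-refl (midpoints-y₁y₂-R₄ x∈Γ a∈x b∈x) λ ()

    impossible : ⊥
    impossible with enumerate-Between {i = 1} {j = 2} wy₀
    ... | [] , () , _
    ... | _ ∷ [] , () , _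
    ... | _ ∷ _ ∷ [] , () , _
    ... | _ ∷ _ ∷ _ ∷ _ ∷ _ , () , _
    ... | x₁ ∷ x₂ ∷ x₃ ∷ [] , _ , (x₁≢x₂ ∷ x₁≢x₃ ∷ []) ∷ (x₂≢x₃ ∷ []) ∷ [] ∷ []
        , x₁∈Γ ∷ x₂∈Γ ∷ x₃∈Γ ∷ []
      with a₁ , a₁∈x₁ ← midpoint x₁∈Γ y₀y₁
      with a₂ , a₂∈x₂ ← midpoint x₂∈Γ y₀y₁
      with a₃ , a₃∈x₃ ← midpoint x₃∈Γ y₀y₁ =
      1+n≰n (Unique-Between⇒length≤p y₁w
               (distinct₃ (y₁-midpoints-differ x₁∈Γ x₂∈Γ x₁≢x₂ a₁∈x₁ a₂∈x₂)
                          (y₁-midpoints-differ x₁∈Γ x₃∈Γ x₁≢x₃ a₁∈x₁ a₃∈x₃)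
                          (y₁-midpoints-differ x₂∈Γ x₃∈Γ x₂≢x₃ a₂∈x₂ a₃∈x₃))
               (midpoint-∈-Γ₁₄ x₁∈Γ y₀y₁ a₁∈x₁ ∷ midpoint-∈-Γ₁₄ x₂∈Γ y₀y₁ a₂∈x₂ ∷
                midpoint-∈-Γ₁₄ x₃∈Γ y₀y₁ a₃∈x₃ ∷ []))

theorem5p4 : (n : ℕ) (rel : Fin n → Fin n → Fin 6) →
    ¬ IsSymmetricAssocScheme zero rel p
theorem5p4 n rel S =
  let open SymmetricAssocScheme S
      w , y₀ , wy₀      = nonempty 1
      y₁ , y₀y₁ , y₁y₀  = 0<p⇒∃Between {i = 3} {j = 3} (rel-refl {y₀}) (s≤s z≤n)
      y₂ , y₁y₂ , y₂y₀  = 0<p⇒∃Between {i = 3} {j = 3} y₁y₀ (s≤s z≤n)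
  in Triangle.impossible S wy₀ y₀y₁ (rel-sym y₂y₀) y₁y₂
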